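{- Suppose the set functor $\mathsf{T}$ preserves weak pullbacks, let $(-)_*$ be a uniform construction for $\mathsf{T}$, and let $\varphi\in\mathtt{1SO}_\Lambda(A)$ for a set $\Lambda$ of monotone predicate liftings and a finite set $A$. Then $(-)_*$ is adequate for $\varphi$ if and only if for every pair of one-step $\overline{\mathsf{T}}$-bisimilar one-step models $(X,\alpha,V)$ and $(Y,\beta,U)$ over $A$ we have $(X_*,\alpha_*,V_{[h_\alpha]})\Vdash_1\varphi\iff(Y_*,\beta_*,U_{[h_\beta]})\Vdash_1\varphi$.
   Context: Set functors are endofunctors on sets assumed to map injective maps to injective maps. $\mathsf{T}$ preserves weak pullbacks if for all $f_1:X_1\to Y$, $f_2:X_2\to Y$ and $\alpha_i\in\mathsf{T}X_i$ with $\mathsf{T}f_1(\alpha_1)=\mathsf{T}f_2(\alpha_2)$, there is $\gamma\in\mathsf{T}R$, $R=\{(u,v)\mid f_1(u)=f_2(v)\}$, with $\mathsf{T}\pi_i(\gamma)=\alpha_i$. Barr extension: for $R\subseteq X_1\times X_2$, $\overline{\mathsf{T}}R=\{(\mathsf{T}\pi_1\gamma,\mathsf{T}\pi_2\gamma)\mid\gamma\in\mathsf{T}R\}$. A one-step model over $A$ is $(X,\alpha,V)$, $\alpha\in\mathsf{T}X$, $V:A\to\mathcal{P}X$; $V^\dagger(x)=\{a\in A\mid x\in V(a)\}$. A one-step $\overline{\mathsf{T}}$-bisimulation between $(X,\alpha,V)$ and $(Y,\beta,U)$ is $R\subseteq X\times Y$ with $V^\dagger(x)=U^\dagger(y)$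 whenever $xRy$, and $(\alpha,\beta)\in\overline{\mathsf{T}}R$. Monotone predicate liftings: natural transformations $\lambda:\mathcal{Q}^n\to\mathcal{Q}\circ\mathsf{T}$ ($\mathcal{Q}$ contravariant powerset) monotone in each argument. $\mathtt{1SO}_\Lambda(A)$: formulas $\varphi::=a\subseteq b\mid\lambda(a_1..a_n)\mid\neg\varphi\mid\varphi\vee\varphi\mid\exists a.\varphi$ ($\lambda\in\Lambda$, auxiliary bound variables allowed) with free variables in $A$, semantics $V(a)\subseteq V(b)$; $\alpha\in\lambda_X(V(a_1),..)$; Booleans; quantification over subsets of $X$. A one-step frame is $(X,\alpha)$, $\alpha\in\mathsf{T}X$; a morphism $h:(X',\alpha')\to(X,\alpha)$ is a map with $\mathsf{T}h(\alpha')=\alpha$. A uniform construction assigns to each frame $(X,\alpha)$ a frame $(X_*,\alpha_*)$ and a morphism $h_\alpha:(X_*,\alpha_*)\to(X,\alpha)$. $V_{[h]}(a)=h^{ -1}(V(a))$. $(-)_*$ is adequate for $\varphi$ if for all frames $(X,\alpha),(Y,\beta)$, every morphism $f:(X,\alpha)\to(Y,\beta)$ and $V:A\to\mathcal{P}Y$: $(X_*,\alpha_*,V_{[f\circ h_\alpha]})\Vdash_1\varphi$ iff $(Y_*,\beta_*,V_{[h_\beta]})\Vdash_1\varphi$. -}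

module Defs where

open import Level using (Level) renaming (suc to lsuc; zero to lzero)
open import Data.Nat using (ℕ)
open import Data.Fin using (Fin)
open import Data.Maybe using (Maybe; just; nothing)
open import Data.Product using (Σ; _×_; _,_; proj₁; proj₂; ∃)
open import Data.Sum using (_⊎_)
open import Relation.Nullary using (¬_)
open import Relation.Binary.PropositionalEquality using (_≡_)
open import Function using (_∘_; id; _⇔_)
open import Function.Definitions using (Injective)

Pred : Set → Set₁
Pred X = X → Set

_⊆_ : {X : Set} → Pred X → Pred X → Set
P ⊆ Q = ∀ x → P x → Q x

record SetFunctor : Set₁ where
  field
    F        : Set → Set
    fmap     : {X Y : Set} → (X → Y) → F X → F Y
    fmap-id  : {X : Set} (t : F X) → fmap id t ≡ t
    fmap-∘   : {X Y Z : Set} (g : Y → Z) (f : X → Y) (t : F X) →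
               fmap (g ∘ f) t ≡ fmap g (fmap f t)
    fmap-cong : {X Y : Set} {f g : X → Y} → (∀ x → f x ≡ g x) →
               (t : F X) → fmap f t ≡ fmap g t
    fmap-inj : {X Y : Set} (f : X → Y) → Injective _≡_ _≡_ f →
               Injective _≡_ _≡_ (fmap f)

module _ (T : SetFunctor) where
  open SetFunctor T

  PB : {X₁ X₂ Y : Set} → (X₁ → Y) → (X₂ → Y) → Set
  PB {X₁} {X₂} f₁ f₂ = Σ (X₁ × X₂) λ p → f₁ (proj₁ p) ≡ f₂ (proj₂ p)

  PreservesWeakPullbacks : Set₁
  PreservesWeakPullbacks =
    {X₁ X₂ Y : Set} (f₁ : X₁ → Y) (f₂ : X₂ → Y) (α₁ : F X₁) (α₂ : F X₂) →
    fmap f₁ α₁ ≡ fmap f₂ α₂ →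
    Σ (F (PB f₁ f₂)) λ γ →
      (fmap (proj₁ ∘ proj₁) γ ≡ α₁) × (fmap (proj₂ ∘ proj₁) γ ≡ α₂)

  Graph : {X₁ X₂ : Set} → (X₁ → X₂ → Set) → Set
  Graph {X₁} {X₂} R = Σ (X₁ × X₂) λ p → R (proj₁ p) (proj₂ p)

  Barr : {X₁ X₂ : Set} → (X₁ → X₂ → Set) → F X₁ → F X₂ → Set
  Barr R α β = Σ (F (Graph R)) λ γ →
    (fmap (proj₁ ∘ proj₁) γ ≡ α) × (fmap (proj₂ ∘ proj₁) γ ≡ β)

  record MonotonePredLifting : Set₁ where
    field
      arity   : ℕ
      lift    : (X : Set) → (Fin arity → Pred X) → Pred (F X)
      natural : {X Y : Set} (f : X → Y) (U : Fin arity → Pred Y) (t : F X) →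
                lift X (λ i → U i ∘ f) t ⇔ lift Y U (fmap f t)
      monotone : (X : Set) (U U' : Fin arity → Pred X) →
                 (∀ i → U i ⊆ U' i) → lift X U ⊆ lift X U'

  record Signature : Set₁ where
    field
      Idx : Set
      lifting : Idx → MonotonePredLifting

  module _ (Λ : Signature) where
    open Signature Λ
    open MonotonePredLifting

    -- 1SO_Λ formulas with variables from Var; ∃ binds a new variable
    data Form (Var : Set) : Set where
      _⊆'_ : Var → Var → Form Var
      lam  : (l : Idx) → (Fin (arity (lifting l)) → Var) → Form Var
      neg  : Form Var → Form Var
      _∨_  : Form Var → Form Var → Form Var
      ex   : Form (Maybe Var) → Form Var

    extend : {Var X : Set} → (Var → Pred X) → Pred X → Maybe Var → Pred X
    extend V P (just a) = V a
    extend V P nothing  = P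

    Sat : {Var : Set} (X : Set) → F X → (Var → Pred X) → Form Var → Set₁
    Sat X α V (a ⊆' b)  = Level.Lift _ (V a ⊆ V b)
    Sat X α V (lam l as) = Level.Lift _ (lift (lifting l) X (V ∘ as) α)
    Sat X α V (neg φ)    = ¬ Sat X α V φ
    Sat X α V (φ ∨ ψ)    = Sat X α V φ ⊎ Sat X α V ψ
    Sat X α V (ex φ)     = Σ (Pred X) λ P → Sat X α (extend V P) φ

  record UniformConstruction : Set₁ where
    field
      carrier : (X : Set) → F X → Set
      elem    : (X : Set) (α : F X) → F (carrier X α)
      hom     : (X : Set) (α : F X) → carrier X α → X
      isMor   : (X : Set) (α : F X) → fmap (hom X α) (elem X α) ≡ α

  module _ (Λ : Signature) (C : UniformConstruction) {A : Set} where
    open UniformConstruction C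

    -- V_[h](a) = h⁻¹(V a)
    pullV : {X Y : Set} → (X → Y) → (A → Pred Y) → A → Pred X
    pullV h V a = V a ∘ h

    Adequate : Form Λ A → Set₁
    Adequate φ = (X Y : Set) (α : F X) (β : F Y) (f : X → Y) →
      fmap f α ≡ β → (V : A → Pred Y) →
      Sat Λ (carrier X α) (elem X α) (pullV (f ∘ hom X α) V) φ ⇔
      Sat Λ (carrier Y β) (elem Y β) (pullV (hom Y β) V) φ

    IsBisim : {X Y : Set} → F X → (A → Pred X) → F Y → (A → Pred Y) →
              (X → Y → Set) → Set₁
    IsBisim α V β U R =
      (∀ x y → R x y → ∀ a → (V a x ⇔ U a y)) × Level.Lift _ (Barr R α β)

    BisimInvariant : Form Λ A → Set₁
    BisimInvariant φ = (X Y : Set) (α : F X) (V : A → Pred X)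
      (β : F Y) (U : A → Pred Y) →
      (Σ (X → Y → Set) λ R → IsBisim α V β U R) →
      Sat Λ (carrier X α) (elem X α) (pullV (hom X α) V) φ ⇔
      Sat Λ (carrier Y β) (elem Y β) (pullV (hom Y β) U) φ

module Submission where

-- The proof rests on two translations between frame
-- morphisms and one-step bisimulations:
--
--   * a bisimulation R between (X,α,V) and (Y,β,U) comes with a witness
--     γ ∈ T(Graph R), and the two projections are frame morphisms
--     (Graph R, γ) → (X, α) and (Graph R, γ) → (Y, β) along which V and U
--     pull back to the same valuation (up to pointwise equivalence);
--   * conversely the graph of a frame morphism f : (X,α) → (Y,β) is a
--     bisimulation between (X, α, V ∘ f) and (Y, β, V).
--
-- Together with the fact that satisfaction only depends on the valuation up
-- to pointwise equivalence, adequacy applied to the two legs of the span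
-- gives invariance, and invariance applied to a graph gives adequacy.
-- Both directions work for an arbitrary set of variables A.

open import Defs
open import Data.Nat using (ℕ)
open import Data.Fin using (Fin)
open import Data.Maybe using (just; nothing)
open import Data.Product using (_,_; proj₁; proj₂)
open import Data.Sum using (inj₁; inj₂)
open import Function using (_∘_; _⇔_)
open import Function.Bundles using (mk⇔; Equivalence)
open import Function.Construct.Identity using (⇔-id)
open import Function.Construct.Symmetry using (⇔-sym)
open import Function.Construct.Composition using (_⇔-∘_)
open import Level using (lift)
open import Relation.Binary.PropositionalEquality using (_≡_; refl; sym; trans)

open Equivalence using (to; from)

module SatInvariance (T : SetFunctor) (Λ : Signature T) where
  open SetFunctor T using (F)
  open Signature Λ using (lifting)
  open MonotonePredLifting using (monotone)

  _≋_ : {Var X : Set} → (Var → Pred X) → (Var → Pred X) → Set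
  V ≋ V' = ∀ a x → V a x ⇔ V' a x

  ≋-sym : {Var X : Set} {V V' : Var → Pred X} → V ≋ V' → V' ≋ V
  ≋-sym e a x = ⇔-sym (e a x)

  extend-≋ : {Var X : Set} {V V' : Var → Pred X} (P : Pred X) → V ≋ V' →
             extend T Λ V P ≋ extend T Λ V' P
  extend-≋ P e (just a) x = e a x
  extend-≋ P e nothing  x = ⇔-id _

  -- One direction, by induction on the formula; the modal case uses
  -- monotonicity of the predicate liftings, negation uses the symmetric
  -- statement.
  sat-transport : {Var X : Set} (α : F X) {V V' : Var → Pred X} → V ≋ V' →
                  (φ : Form T Λ Var) → Sat T Λ X α V φ → Sat T Λ X α V' φ
  sat-transport α e (a ⊆' b) (lift V⊆) =
    lift (λ x p → to (e b x) (V⊆ x (from (e a x) p)))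
  sat-transport {X = X} α e (lam l as) (lift s) =
    lift (monotone (lifting l) X _ _ (λ i x → to (e (as i) x)) α s)
  sat-transport α e (neg φ) ¬s s' = ¬s (sat-transport α (≋-sym e) φ s')
  sat-transport α e (φ ∨ ψ) (inj₁ s) = inj₁ (sat-transport α e φ s)
  sat-transport α e (φ ∨ ψ) (inj₂ s) = inj₂ (sat-transport α e ψ s)
  sat-transport α e (ex φ) (P , s) = P , sat-transport α (extend-≋ P e) φ s

  sat-≋ : {Var X : Set} (α : F X) {V V' : Var → Pred X} → V ≋ V' →
          (φ : Form T Λ Var) → Sat T Λ X α V φ ⇔ Sat T Λ X α V' φ
  sat-≋ α e φ = mk⇔ (sat-transport α e φ) (sat-transport α (≋-sym e) φ)

module MorphismsAndBisimulations (T : SetFunctor) (Λ : Signature T)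
                                 (C : UniformConstruction T) {A : Set} where
  open SetFunctor T
  open SatInvariance T Λ

  π₁ : {X Y : Set} {R : X → Y → Set} → Graph T R → X
  π₁ = proj₁ ∘ proj₁

  π₂ : {X Y : Set} {R : X → Y → Set} → Graph T R → Y
  π₂ = proj₂ ∘ proj₁

  bisim-pullbacks-agree :
    {X Y Z : Set} {α : F X} {V : A → Pred X} {β : F Y} {U : A → Pred Y}
    {R : X → Y → Set} → IsBisim T Λ C α V β U R → (h : Z → Graph T R) →
    pullV T Λ C (π₁ ∘ h) V ≋ pullV T Λ C (π₂ ∘ h) U
  bisim-pullbacks-agree (labels , _) h a z =
    let ((x , y) , xRy) = h z in labels x y xRy a

  graph-is-bisim : {X Y : Set} (α : F X) (β : F Y) (f : X → Y) →
    fmap f α ≡ β → (V : A → Pred Y) →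
    IsBisim T Λ C α (pullV T Λ C f V) β V (λ x y → f x ≡ y)
  graph-is-bisim α β f fα≡β V = labels , lift (γ , γ↦α , γ↦β)
    where
    labels : ∀ x y → f x ≡ y → ∀ a → (V a (f x) ⇔ V a y)
    labels x .(f x) refl a = ⇔-id _

    γ : F (Graph T (λ x y → f x ≡ y))
    γ = fmap (λ x → (x , f x) , refl) α

    γ↦α : fmap π₁ γ ≡ α
    γ↦α = trans (sym (fmap-∘ π₁ _ α)) (fmap-id α)

    γ↦β : fmap π₂ γ ≡ β
    γ↦β = trans (sym (fmap-∘ π₂ _ α)) fα≡β

  open UniformConstruction C

  adequate⇒invariant : (φ : Form T Λ A) →
    Adequate T Λ C φ → BisimInvariant T Λ C φ
  adequate⇒invariant φ adequate X Y α V β U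
                     (R , bisim@(_ , lift (γ , γ↦α , γ↦β))) =
    ad₂ ⇔-∘ (agree ⇔-∘ ⇔-sym ad₁)
    where
    Z : Set
    Z = Graph T R

    _,_⊩φ_ : (W : Set) (δ : F W) → (A → Pred (carrier W δ)) → Set₁
    W , δ ⊩φ V' = Sat T Λ (carrier W δ) (elem W δ) V' φ

    ad₁ : (Z , γ ⊩φ pullV T Λ C (π₁ ∘ hom Z γ) V) ⇔
          (X , α ⊩φ pullV T Λ C (hom X α) V)
    ad₁ = adequate Z X γ α π₁ γ↦α V

    ad₂ : (Z , γ ⊩φ pullV T Λ C (π₂ ∘ hom Z γ) U) ⇔
          (Y , β ⊩φ pullV T Λ C (hom Y β) U)
    ad₂ = adequate Z Y γ β π₂ γ↦β U

    agree : (Z , γ ⊩φ pullV T Λ C (π₁ ∘ hom Z γ) V) ⇔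
            (Z , γ ⊩φ pullV T Λ C (π₂ ∘ hom Z γ) U)
    agree = sat-≋ (elem Z γ) (bisim-pullbacks-agree bisim (hom Z γ)) φ

  invariant⇒adequate : (φ : Form T Λ A) →
    BisimInvariant T Λ C φ → Adequate T Λ C φ
  invariant⇒adequate φ invariant X Y α β f fα≡β V =
    invariant X Y α (pullV T Λ C f V) β V
      (_ , graph-is-bisim α β f fα≡β V)

proposition5p14 : (T : SetFunctor) → PreservesWeakPullbacks T →
    (C : UniformConstruction T) (Λ : Signature T) (k : ℕ)
    (φ : Form T Λ (Fin k)) →
    Adequate T Λ C φ ⇔ BisimInvariant T Λ C φ
proposition5p14 T _ C Λ k φ =
  mk⇔ (adequate⇒invariant φ) (invariant⇒adequate φ)
  where open MorphismsAndBisimulations T Λ C {Fin k}
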